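{- Let $m\ge 1$ and $D_1,\dots,D_m\ge 1$ be integers, $n=D_1+\cdots+D_m$, and $a\ge 1$ an integer. Consider a deck with $D_i$ cards labelled $i$, initially sorted with all $1$'s on top, then all $2$'s, ..., all $m$'s at the bottom. Let $w^*$ be the reversed arrangement ($m$'s on top, then $(m-1)$'s, ..., $1$'s at the bottom). Then after an $a$-shuffle, $w^*$ is a least likely arrangement: $Q_a(w^*)\le Q_a(w)$ for every arrangement $w$.
   Context: An arrangement is a word (read top to bottom) in the letters $1,\dots,m$ with exactly $D_i$ copies of $i$. An $a$-shuffle: cut the deck from the top into $a$ consecutive packets (possibly empty) of sizes $(A_1,\dots,A_a)$ with probability $a^{ -n}\binom{n}{A_1,\ldots,A_a}$, then interleave them by repeatedly dropping a card from a packet chosen with probability proportional to its current size (equivalently, all order-preserving interleavings equally likely). $Q_a(w)$ denotes the probability that the resulting arrangement is $w$. -}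

module Defs where

open import Data.Nat as ℕ using (ℕ; zero; suc; _∸_; _^_; _!)
open import Data.Integer using (+_)
open import Data.Fin as Fin using (Fin)
open import Data.List as List using (List; []; _∷_; length; filter; replicate; concatMap; map; allFin; upTo; take; drop; reverse; foldr)
open import Data.List.Properties as ListP using ()
open import Data.Vec as Vec using (Vec; []; _∷_; lookup; tabulate; _[_]≔_; toList)
open import Data.Vec.Properties as VecP using ()
open import Data.Rational as ℚ using (ℚ; 0ℚ; 1ℚ; _+_; _*_; _/_)
open import Relation.Binary.PropositionalEquality using (_≡_)
open import Relation.Nullary.Decidable using (does)
open import Data.Bool using (Bool; true; false)
open import Data.Nat.ListAction using (product)

-- Division of naturals into ℚ.  The denominator-0 branch is a totality
-- convention only; it is never used (all denominators below are ≥ 1 when a ≥ 1).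
_÷ℕ_ : ℕ → ℕ → ℚ
x ÷ℕ zero  = 0ℚ
x ÷ℕ suc d = (+ x) / suc d

sumℚ : List ℚ → ℚ
sumℚ = foldr _+_ 0ℚ

count : ∀ {k} → Fin k → List (Fin k) → ℕ
count i w = length (filter (λ x → x Fin.≟ i) w)

IsArrangement : ∀ {m} → (Fin m → ℕ) → List (Fin m) → Set
IsArrangement D w = ∀ i → count i w ≡ D i

-- the sorted deck: all 1's on top, then 2's, ..., m's at the bottom (head = top)
sortedDeck : ∀ {m} → (Fin m → ℕ) → List (Fin m)
sortedDeck {m} D = concatMap (λ i → replicate (D i) i) (allFin m)

words : (a n : ℕ) → List (List (Fin a))
words a zero    = [] ∷ []
words a (suc n) = concatMap (λ s → map (_∷ s) (allFin a)) (words a n)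

compositions : (a n : ℕ) → List (Vec ℕ a)
compositions zero    zero    = [] ∷ []
compositions zero    (suc n) = []
compositions (suc a) n       =
  concatMap (λ k → map (k ∷_) (compositions a (n ∸ k))) (upTo (suc n))

cut : ∀ {X : Set} {a} → Vec ℕ a → List X → Vec (List X) a
cut []      xs = []
cut (k ∷ A) xs = take k xs ∷ cut A (drop k xs)

-- interleave packets: the t-th card of the result is the top card of packet s_t
interleave : ∀ {X : Set} {a} → Vec (List X) a → List (Fin a) → List X
interleave ps []      = []
interleave ps (j ∷ s) with lookup ps j
... | []     = interleave ps s
... | x ∷ xs = x ∷ interleave (ps [ j ]≔ xs) s

content : ∀ {a} → List (Fin a) → Vec ℕ a
content s = tabulate (λ j → count j s)

-- order-preserving interleavings of packets of sizes A, encoded by the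
-- sequence of packets from which successive cards are drawn
interleavings : ∀ {a} (n : ℕ) → Vec ℕ a → List (List (Fin a))
interleavings {a} n A =
  filter (λ s → VecP.≡-dec ℕ._≟_ (content s) A) (words a n)

multinomial : ∀ {a} → ℕ → Vec ℕ a → ℚ
multinomial n A = (n !) ÷ℕ product (toList (Vec.map _! A))

cutProb : (a n : ℕ) → Vec ℕ a → ℚ
cutProb a n A = multinomial n A * (1 ÷ℕ (a ^ n))

Q : ∀ {m} (a : ℕ) → (deck w : List (Fin m)) → ℚ
Q {m} a deck w = sumℚ (map term (compositions a n))
  where
  n = length deck
  term : Vec ℕ a → ℚ
  term A =
    cutProb a n A *
    (length (filter (λ s → ListP.≡-dec Fin._≟_ (interleave (cut A deck) s) w)
                    (interleavings n A))
      ÷ℕ length (interleavings n A))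

module Submission where

-- Q a deck w is a sum over cuts A of a nonnegative weight times the number
-- outcomes(w) of interleavings (draw sequences s of content A) of the packets
-- that produce w; all packets of the sorted deck are sorted.  Let w contain an
-- adjacent pair y x with x < y.  Two consecutive cards from one sorted packet
-- come out in increasing order, so y and x were drawn from different packets,
-- and exchanging these two draws yields an interleaving producing w with y x
-- replaced by x y.  Exchanging two positions permutes the draw sequences of
-- length n, hence outcomes(.. y x ..) ≤ outcomes(.. x y ..).
--
-- Insertion sort into decreasing order reaches any word w from its sorted form
-- by a chain of such exchanges, and for an arrangement that sorted form is w*,
-- because a decreasing word is determined by its letter counts.  So
-- outcomes(w*) ≤ outcomes(w) for every cut, and Q a deck w* ≤ Q a deck w.

open import Defs
open import Data.Nat using (ℕ; _≤_)
open import Data.Fin using (Fin)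
open import Data.List using (List; reverse)
open import Data.Rational using (ℚ)
open import Data.Rational using () renaming (_≤_ to _≤ℚ_)

open import Level using (Level)
open import Function using (flip; _∘_)
open import Data.Bool using (if_then_else_)
open import Data.Empty using (⊥; ⊥-elim)
open import Data.Product using (_,_)
open import Data.Nat as ℕ using (zero; suc; _+_; _*_; z≤n; s≤s)
import Data.Nat.Properties as ℕP
open import Algebra.Properties.CommutativeSemigroup ℕP.+-commutativeSemigroup using (interchange)
open import Data.Nat.ListAction using (sum; product)
open import Data.Nat.ListAction.Properties using (sum-++)
import Data.Integer as ℤ
import Data.Integer.Properties as ℤP
open import Data.Fin as Fin using (_≟_)
import Data.Fin.Properties as FinP
open import Data.List as List
  using ([]; _∷_; _++_; length; filter; map; allFin; concatMap; replicate)
open import Data.List.Properties as ListP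
  using (length-++; filter-++; filter-accept; filter-reject; filter-all; filter-none;
         length-replicate; unfold-reverse)
open import Data.List.Membership.Propositional using (_∈_)
open import Data.List.Membership.Propositional.Properties using (∈-allFin)
open import Data.List.Relation.Unary.Any using (here; there)
open import Data.List.Relation.Unary.All as All using (All; []; _∷_)
import Data.List.Relation.Unary.All.Properties as AllP
open import Data.List.Relation.Unary.AllPairs as AllPairs using (AllPairs; []; _∷_)
import Data.List.Relation.Unary.AllPairs.Properties as AllPairsP
open import Data.List.Relation.Unary.Linked.Properties using (Linked⇒AllPairs)
open import Data.List.Relation.Unary.Unique.Propositional using (Unique)
open import Data.List.Relation.Unary.Unique.Propositional.Properties using (allFin⁺)
open import Data.List.Relation.Binary.Permutation.Propositional using (_↭_; ↭-sym; ↭-refl; prep; swap)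
open import Data.List.Relation.Binary.Permutation.Propositional.Properties
  using (↭-length; filter-↭; ↭-reverse; All-resp-↭)
import Data.List.Sort.InsertionSort.Base as InsertionSort
import Data.List.Sort.InsertionSort.Properties as InsertionSortP
open import Data.Vec as Vec using (Vec; []; _∷_; lookup; _[_]≔_)
import Data.Vec.Properties as VecP
open import Data.Rational as ℚ using (NonNegative)
import Data.Rational.Properties as ℚP
import Data.Rational.Unnormalised as ℚᵘ
import Data.Rational.Unnormalised.Properties as ℚᵘP
open import Relation.Binary using (Rel; Reflexive; Antisymmetric; DecidableEquality; DecTotalOrder)
import Relation.Binary.Construct.Flip.EqAndOrd as Flip
open import Relation.Binary.PropositionalEquality
open import Relation.Nullary using (yes; no; does; ¬_; contradiction)
open import Relation.Unary using (Pred; Decidable)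
open import Relation.Unary.Properties using (_∩?_)

private
  variable
    ℓ ℓ′ : Level
    X : Set

-- Letter counts

module _ {k : ℕ} where

  count-↭ : ∀ (i : Fin k) {xs ys} → xs ↭ ys → count i xs ≡ count i ys
  count-↭ i p = ↭-length (filter-↭ (_≟ i) p)

  count-head : ∀ (i : Fin k) xs → count i (i ∷ xs) ≡ suc (count i xs)
  count-head i xs = cong length (filter-accept (_≟ i) refl)

  count-++ : ∀ (i : Fin k) xs ys → count i (xs ++ ys) ≡ count i xs + count i ys
  count-++ i xs ys = trans (cong length (filter-++ (_≟ i) xs ys)) (length-++ (filter (_≟ i) xs))

  count-∷-cancel : ∀ (i x : Fin k) xs ys →
    count i (x ∷ xs) ≡ count i (x ∷ ys) → count i xs ≡ count i ys
  count-∷-cancel i x xs ys e with x ≟ i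
  ... | yes _ = ℕP.suc-injective e
  ... | no _  = e

  count-suc⇒∈ : ∀ (i : Fin k) xs {c} → count i xs ≡ suc c → i ∈ xs
  count-suc⇒∈ i (x ∷ xs) e with x ≟ i
  ... | yes refl = here refl
  ... | no _     = there (count-suc⇒∈ i xs e)

  count-unique : ∀ {i : Fin k} {xs} → Unique xs → i ∈ xs → count i xs ≡ 1
  count-unique {i} (i∉xs ∷ _) (here refl) =
    trans (count-head i _)
          (cong (suc ∘ length) (filter-none (_≟ i) (All.map (λ i≢x x≡i → i≢x (sym x≡i)) i∉xs)))
  count-unique {i} {x ∷ _} (x∉xs ∷ u) (there i∈xs) =
    trans (cong length (filter-reject (_≟ i) (All.lookup x∉xs i∈xs))) (count-unique u i∈xs)

  count-replicate-self : ∀ (i : Fin k) n → count i (replicate n i) ≡ n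
  count-replicate-self i n =
    trans (cong length (filter-all (_≟ i) (AllP.replicate⁺ n refl))) (length-replicate n)

  count-replicate-other : ∀ {i x : Fin k} n → x ≢ i → count i (replicate n x) ≡ 0
  count-replicate-other {i} n x≢i = cong length (filter-none (_≟ i) (AllP.replicate⁺ n x≢i))

  blocks : (Fin k → ℕ) → List (Fin k) → List (Fin k)
  blocks D = concatMap (λ j → replicate (D j) j)

  count-blocks : ∀ (D : Fin k → ℕ) i xs → count i (blocks D xs) ≡ D i * count i xs
  count-blocks D i [] = sym (ℕP.*-zeroʳ (D i))
  count-blocks D i (x ∷ xs) with x ≟ i
  ... | yes refl = begin
    count i (replicate (D i) i ++ blocks D xs)     ≡⟨ count-++ i (replicate (D i) i) _ ⟩
    count i (replicate (D i) i) + count i (blocks D xs)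
                                                  ≡⟨ cong₂ _+_ (count-replicate-self i (D i)) (count-blocks D i xs) ⟩
    D i + D i * count i xs                         ≡⟨ sym (ℕP.*-suc (D i) _) ⟩
    D i * suc (count i xs)                         ∎
    where open ≡-Reasoning
  ... | no x≢i = begin
    count i (replicate (D x) x ++ blocks D xs)     ≡⟨ count-++ i (replicate (D x) x) _ ⟩
    count i (replicate (D x) x) + count i (blocks D xs)
                                                  ≡⟨ cong₂ _+_ (count-replicate-other (D x) x≢i) (count-blocks D i xs) ⟩
    D i * count i xs                               ∎
    where open ≡-Reasoning

count-sortedDeck : ∀ {m} (D : Fin m → ℕ) i → count i (sortedDeck D) ≡ D i
count-sortedDeck {m} D i = begin
  count i (blocks D (allFin m))  ≡⟨ count-blocks D i (allFin m) ⟩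
  D i * count i (allFin m)       ≡⟨ cong (D i *_) (count-unique (allFin⁺ m) (∈-allFin i)) ⟩
  D i * 1                        ≡⟨ ℕP.*-identityʳ (D i) ⟩
  D i                            ∎
  where open ≡-Reasoning

-- Sorted words: a word is sorted for a relation _≼_ when AllPairs _≼_ holds.

replicate-sorted : ∀ {_≼_ : Rel X ℓ} {x} → x ≼ x → ∀ n → AllPairs _≼_ (replicate n x)
replicate-sorted x≼x zero    = []
replicate-sorted x≼x (suc n) = AllP.replicate⁺ n x≼x ∷ replicate-sorted x≼x n

reverse-sorted : ∀ {_≼_ : Rel X ℓ} {xs} → AllPairs _≼_ xs → AllPairs (flip _≼_) (reverse xs)
reverse-sorted [] = []
reverse-sorted {_≼_ = _≼_} {x ∷ xs} (x≼xs ∷ s) =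
  subst (AllPairs (flip _≼_)) (sym (unfold-reverse x xs))
    (AllPairsP.++⁺ (reverse-sorted s) ([] ∷ [])
      (All.map (_∷ []) (All-resp-↭ (↭-sym (↭-reverse xs)) x≼xs)))

sorted-unique : ∀ {k} {_≼_ : Rel (Fin k) ℓ} → Reflexive _≼_ → Antisymmetric _≡_ _≼_ →
  ∀ {xs ys} → AllPairs _≼_ xs → AllPairs _≼_ ys → (∀ i → count i xs ≡ count i ys) → xs ≡ ys
sorted-unique {_≼_ = _≼_} ≼-refl ≼-antisym = unique
  where
  head-least : ∀ {x xs z} → All (x ≼_) xs → z ∈ x ∷ xs → x ≼ z
  head-least _    (here refl) = ≼-refl
  head-least x≼xs (there z∈) = All.lookup x≼xs z∈

  unique : ∀ {xs ys} → AllPairs _≼_ xs → AllPairs _≼_ ys → (∀ i → count i xs ≡ count i ys) → xs ≡ ys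
  unique [] [] _ = refl
  unique [] (_∷_ {y} {ys} _ _) c = contradiction (trans (c y) (count-head y ys)) ℕP.0≢1+n
  unique (_∷_ {x} {xs} _ _) [] c = contradiction (trans (sym (c x)) (count-head x xs)) ℕP.0≢1+n
  unique (_∷_ {x} {xs} x≼xs sx) (_∷_ {y} {ys} y≼ys sy) c
    with ≼-antisym (head-least x≼xs (count-suc⇒∈ y (x ∷ xs) (trans (c y) (count-head y ys))))
                   (head-least y≼ys (count-suc⇒∈ x (y ∷ ys) (trans (sym (c x)) (count-head x xs))))
  ... | refl = cong (x ∷_) (unique sx sy (λ i → count-∷-cancel i x xs ys (c i)))

blocks-ascending : ∀ {k} (D : Fin k → ℕ) {xs} → AllPairs Fin._≤_ xs → AllPairs Fin._≤_ (blocks D xs)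
blocks-ascending D []                   = []
blocks-ascending D {x ∷ _} (x≤xs ∷ s) =
  AllPairsP.++⁺ (replicate-sorted FinP.≤-refl (D x)) (blocks-ascending D s)
    (AllP.replicate⁺ (D x) (below-blocks x≤xs))
  where
  below-blocks : ∀ {x xs} → All (x Fin.≤_) xs → All (x Fin.≤_) (blocks D xs)
  below-blocks []           = []
  below-blocks (x≤y ∷ x≤ys) = AllP.++⁺ (AllP.replicate⁺ _ x≤y) (below-blocks x≤ys)

sortedDeck-ascending : ∀ {m} (D : Fin m → ℕ) → AllPairs Fin._≤_ (sortedDeck D)
sortedDeck-ascending D = blocks-ascending D (AllPairsP.tabulate⁺-< ℕP.<⇒≤)

∑ : (X → ℕ) → List X → ℕ
∑ f xs = sum (map f xs)

∑-++ : ∀ (f : X → ℕ) xs ys → ∑ f (xs ++ ys) ≡ ∑ f xs + ∑ f ys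
∑-++ f xs ys = trans (cong sum (ListP.map-++ f xs ys)) (sum-++ (map f xs) _)

∑-cong : ∀ {f g : X → ℕ} → (∀ x → f x ≡ g x) → ∀ xs → ∑ f xs ≡ ∑ g xs
∑-cong f≡g xs = cong sum (ListP.map-cong f≡g xs)

∑-mono : ∀ {f g : X → ℕ} → (∀ x → f x ≤ g x) → ∀ xs → ∑ f xs ≤ ∑ g xs
∑-mono f≤g []       = z≤n
∑-mono f≤g (x ∷ xs) = ℕP.+-mono-≤ (f≤g x) (∑-mono f≤g xs)

∑-+ : ∀ (f g : X → ℕ) xs → ∑ (λ x → f x + g x) xs ≡ ∑ f xs + ∑ g xs
∑-+ f g []       = refl
∑-+ f g (x ∷ xs) =
  trans (cong (f x + g x +_) (∑-+ f g xs)) (interchange (f x) (g x) (∑ f xs) (∑ g xs))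

∑-zero : ∀ (xs : List X) → ∑ (λ _ → 0) xs ≡ 0
∑-zero []       = refl
∑-zero (_ ∷ xs) = ∑-zero xs

∑-comm : ∀ {Y : Set} (g : X → Y → ℕ) xs ys →
  ∑ (λ y → ∑ (λ x → g x y) xs) ys ≡ ∑ (λ x → ∑ (λ y → g x y) ys) xs
∑-comm g xs []       = sym (∑-zero xs)
∑-comm g xs (y ∷ ys) = trans (cong (∑ (λ x → g x y) xs +_) (∑-comm g xs ys))
                             (sym (∑-+ (λ x → g x y) (λ x → ∑ (g x) ys) xs))

𝟙 : ∀ {P : Pred X ℓ} → Decidable P → X → ℕ
𝟙 P? x = if does (P? x) then 1 else 0

𝟙-mono : ∀ {P : Pred X ℓ} {Q : Pred X ℓ′} (P? : Decidable P) (Q? : Decidable Q) {x y} →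
  (P x → Q y) → 𝟙 P? x ≤ 𝟙 Q? y
𝟙-mono P? Q? {x} {y} P⇒Q with P? x | Q? y
... | no _   | _      = z≤n
... | yes _  | yes _  = s≤s z≤n
... | yes px | no ¬qy = contradiction (P⇒Q px) ¬qy

length-filter-filter : ∀ {P : Pred X ℓ} {Q : Pred X ℓ′} (P? : Decidable P) (Q? : Decidable Q) xs →
  length (filter Q? (filter P? xs)) ≡ ∑ (𝟙 (P? ∩? Q?)) xs
length-filter-filter P? Q? []       = refl
length-filter-filter P? Q? (x ∷ xs) with P? x
... | no _ = length-filter-filter P? Q? xs
... | yes _ with Q? x
...   | yes _ = cong suc (length-filter-filter P? Q? xs)
...   | no _  = length-filter-filter P? Q? xs

-- Sums over all draw sequences of a given length

-- Exchange of the entries at positions p and p+1 (identity if they do not exist).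
swapAt : ℕ → List X → List X
swapAt zero    (x ∷ y ∷ s) = y ∷ x ∷ s
swapAt (suc p) (x ∷ s)     = x ∷ swapAt p s
swapAt _       s           = s

swapAt-↭ : ∀ p (s : List X) → swapAt p s ↭ s
swapAt-↭ zero    []          = ↭-refl
swapAt-↭ zero    (x ∷ [])    = ↭-refl
swapAt-↭ zero    (x ∷ y ∷ s) = swap y x ↭-refl
swapAt-↭ (suc p) []          = ↭-refl
swapAt-↭ (suc p) (x ∷ s)     = prep x (swapAt-↭ p s)

module _ {a : ℕ} where

  ∑-words-suc : ∀ (h : List (Fin a) → ℕ) n →
    ∑ h (words a (suc n)) ≡ ∑ (λ s → ∑ (λ j → h (j ∷ s)) (allFin a)) (words a n)
  ∑-words-suc h n = trans (∑-concatMap (words a n)) (∑-cong (λ s → ∑-map (allFin a)) (words a n))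
    where
    ∑-map : ∀ {s} js → ∑ h (map (_∷ s) js) ≡ ∑ (λ j → h (j ∷ s)) js
    ∑-map js = cong sum (sym (ListP.map-∘ js))
    ∑-concatMap : ∀ ss → ∑ h (concatMap (λ s → map (_∷ s) (allFin a)) ss)
                        ≡ ∑ (λ s → ∑ h (map (_∷ s) (allFin a))) ss
    ∑-concatMap []       = refl
    ∑-concatMap (s ∷ ss) = trans (∑-++ h (map (_∷ s) (allFin a)) _) (cong (_ +_) (∑-concatMap ss))

  ∑-words-mono : ∀ n {h g : List (Fin a) → ℕ} → (∀ s → length s ≡ n → h s ≤ g s) →
    ∑ h (words a n) ≤ ∑ g (words a n)
  ∑-words-mono zero    h≤g = ℕP.+-mono-≤ (h≤g [] refl) z≤n
  ∑-words-mono (suc n) {h} {g} h≤g =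
    subst₂ _≤_ (sym (∑-words-suc h n)) (sym (∑-words-suc g n))
      (∑-words-mono n (λ s ∣s∣ → ∑-mono (λ j → h≤g (j ∷ s) (cong suc ∣s∣)) (allFin a)))

  -- Exchanging two draws permutes the draw sequences of each length,
  -- so it does not change a sum over them.
  ∑-words-swapAt : ∀ p n (h : List (Fin a) → ℕ) →
    ∑ h (words a n) ≡ ∑ (λ s → h (swapAt p s)) (words a n)
  ∑-words-swapAt zero    zero          h = refl
  ∑-words-swapAt (suc p) zero          h = refl
  ∑-words-swapAt zero    (suc zero)    h =
    trans (∑-words-suc h 0) (sym (∑-words-suc (λ s → h (swapAt zero s)) 0))
  ∑-words-swapAt zero    (suc (suc n)) h = begin
    ∑ h (words a (2 + n))
      ≡⟨ trans (∑-words-suc h (suc n)) (∑-words-suc _ n) ⟩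
    ∑ (λ s → ∑ (λ k → ∑ (λ j → h (j ∷ k ∷ s)) (allFin a)) (allFin a)) (words a n)
      ≡⟨ ∑-cong (λ s → ∑-comm (λ j k → h (j ∷ k ∷ s)) (allFin a) (allFin a)) (words a n) ⟩
    ∑ (λ s → ∑ (λ j → ∑ (λ k → h (j ∷ k ∷ s)) (allFin a)) (allFin a)) (words a n)
      ≡⟨ sym (trans (∑-words-suc _ (suc n)) (∑-words-suc _ n)) ⟩
    ∑ (λ s → h (swapAt zero s)) (words a (2 + n))   ∎
    where open ≡-Reasoning
  ∑-words-swapAt (suc p) (suc n) h = begin
    ∑ h (words a (suc n))                                        ≡⟨ ∑-words-suc h n ⟩
    ∑ (λ s → ∑ (λ j → h (j ∷ s)) (allFin a)) (words a n)          ≡⟨ ∑-words-swapAt p n _ ⟩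
    ∑ (λ s → ∑ (λ j → h (j ∷ swapAt p s)) (allFin a)) (words a n) ≡⟨ sym (∑-words-suc _ n) ⟩
    ∑ (λ s → h (swapAt (suc p) s)) (words a (suc n))              ∎
    where open ≡-Reasoning

-- Interleaving packets

module _ {a : ℕ} where

  interleave-length : ∀ (ps : Vec (List X) a) s → length (interleave ps s) ≤ length s
  interleave-length ps []      = z≤n
  interleave-length ps (j ∷ s) with lookup ps j
  ... | []     = ℕP.m≤n⇒m≤1+n (interleave-length ps s)
  ... | x ∷ xs = s≤s (interleave-length (ps [ j ]≔ xs) s)

  interleave-not-longer : ∀ (ps : Vec (List X) a) s {w} →
    interleave ps s ≡ w → length w ≡ suc (length s) → ⊥
  interleave-not-longer ps s refl ∣w∣ =
    ℕP.≤⇒≯ (interleave-length ps s) (ℕP.≤-reflexive (sym ∣w∣))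

  interleave-draw : ∀ (ps : Vec (List X) a) j {z zs} → lookup ps j ≡ z ∷ zs →
    ∀ {s} → interleave ps (j ∷ s) ≡ z ∷ interleave (ps [ j ]≔ zs) s
  interleave-draw ps j e with lookup ps j
  interleave-draw ps j refl | _ = refl

  SortedPackets : Rel X ℓ → Vec (List X) a → Set _
  SortedPackets _≼_ ps = ∀ j → AllPairs _≼_ (lookup ps j)

  draw-sorted : ∀ {_≼_ : Rel X ℓ} (ps : Vec (List X) a) → SortedPackets _≼_ ps →
    ∀ j {z zs} → lookup ps j ≡ z ∷ zs → SortedPackets _≼_ (ps [ j ]≔ zs)
  draw-sorted {_≼_ = _≼_} ps sorted j {zs = zs} e j′ with j′ Fin.≟ j
  ... | yes refl = subst (AllPairs _≼_) (sym (VecP.lookup∘update j ps zs))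
                         (AllPairs.tail (subst (AllPairs _≼_) e (sorted j)))
  ... | no j′≢j = subst (AllPairs _≼_) (sym (VecP.lookup∘update′ j′≢j ps zs)) (sorted j′)

  -- The key step, at the front: if s draws y and then x from sorted packets,
  -- with y ⋠ x and no draw from an empty packet, then the two draws came from
  -- different packets, and exchanging them outputs x and then y.
  interleave-swap-front : ∀ {_≼_ : Rel X ℓ} (ps : Vec (List X) a) → SortedPackets _≼_ ps →
    ∀ {x y} v j k s → ¬ (y ≼ x) → length s ≡ length v →
    interleave ps (j ∷ k ∷ s) ≡ y ∷ x ∷ v → interleave ps (k ∷ j ∷ s) ≡ x ∷ y ∷ v
  interleave-swap-front ps sorted v j k s y⋠x ∣s∣ eq with lookup ps j in ej
  ... | [] = ⊥-elim (interleave-not-longer ps (k ∷ s) eq (cong (suc ∘ suc) (sym ∣s∣)))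
  ... | z ∷ zs with refl , eq₁ ← ListP.∷-injective eq with lookup (ps [ j ]≔ zs) k in ek
  ...   | [] = ⊥-elim (interleave-not-longer (ps [ j ]≔ zs) s eq₁ (cong suc (sym ∣s∣)))
  ...   | z′ ∷ zs′ with refl , eq₂ ← ListP.∷-injective eq₁ with j Fin.≟ k
  ...     | yes refl =
    contradiction (All.head (AllPairs.head (subst (AllPairs _) two-on-top (sorted j)))) y⋠x
    where
    two-on-top : lookup ps j ≡ z ∷ z′ ∷ zs′
    two-on-top = trans ej (cong (z ∷_) (trans (sym (VecP.lookup∘update j ps zs)) ek))
  ...     | no j≢k = begin
    interleave ps (k ∷ j ∷ s)
      ≡⟨ interleave-draw ps k (trans (sym (VecP.lookup∘update′ k≢j ps zs)) ek) ⟩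
    z′ ∷ interleave (ps [ k ]≔ zs′) (j ∷ s)
      ≡⟨ cong (z′ ∷_) (interleave-draw (ps [ k ]≔ zs′) j (trans (VecP.lookup∘update′ j≢k ps zs′) ej)) ⟩
    z′ ∷ z ∷ interleave (ps [ k ]≔ zs′ [ j ]≔ zs) s
      ≡⟨ cong (λ qs → z′ ∷ z ∷ interleave qs s) (VecP.[]≔-commutes ps k j k≢j) ⟩
    z′ ∷ z ∷ interleave (ps [ j ]≔ zs [ k ]≔ zs′) s
      ≡⟨ cong (λ t → z′ ∷ z ∷ t) eq₂ ⟩
    z′ ∷ z ∷ v ∎
    where
    open ≡-Reasoning
    k≢j : k ≢ j
    k≢j k≡j = j≢k (sym k≡j)

  interleave-swapAt : ∀ {_≼_ : Rel X ℓ} (ps : Vec (List X) a) → SortedPackets _≼_ ps →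
    ∀ u {x y} v s → ¬ (y ≼ x) → length s ≡ length (u ++ y ∷ x ∷ v) →
    interleave ps s ≡ u ++ y ∷ x ∷ v → interleave ps (swapAt (length u) s) ≡ u ++ x ∷ y ∷ v
  interleave-swapAt ps sorted []       v (j ∷ k ∷ s) y⋠x ∣s∣ eq =
    interleave-swap-front ps sorted v j k s y⋠x (ℕP.suc-injective (ℕP.suc-injective ∣s∣)) eq
  interleave-swapAt ps sorted (_ ∷ u)  v (j ∷ s)     y⋠x ∣s∣ eq with lookup ps j in ej
  ... | [] = ⊥-elim (interleave-not-longer ps s eq (sym ∣s∣))
  ... | z ∷ zs with refl , eq₁ ← ListP.∷-injective eq =
    cong (z ∷_) (interleave-swapAt (ps [ j ]≔ zs) (draw-sorted ps sorted j ej) u v s y⋠x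
                                   (ℕP.suc-injective ∣s∣) eq₁)

cut-sorted : ∀ {a} {_≼_ : Rel X ℓ} (A : Vec ℕ a) {xs} → AllPairs _≼_ xs → SortedPackets _≼_ (cut A xs)
cut-sorted (k ∷ A) sorted Fin.zero    = AllPairsP.take⁺ k sorted
cut-sorted (k ∷ A) sorted (Fin.suc j) = cut-sorted A (AllPairsP.drop⁺ k sorted) j

-- Chains of exchanges

length-exchange : ∀ {a} {A : Set a} (u : List A) {x y} v → length (u ++ x ∷ y ∷ v) ≡ length (u ++ y ∷ x ∷ v)
length-exchange u v = trans (length-++ u) (sym (length-++ u))

data SwapChain {a r} {A : Set a} (R : Rel A r) : List A → List A → Set (a Level.⊔ r) where
  done : ∀ {w} → SwapChain R w w
  step : ∀ {w} u {x y} v → R x y → SwapChain R w (u ++ y ∷ x ∷ v) → SwapChain R w (u ++ x ∷ y ∷ v)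

chain-∷ : ∀ {a r} {A : Set a} {R : Rel A r} z {w₁ w₂} →
  SwapChain R w₁ w₂ → SwapChain R (z ∷ w₁) (z ∷ w₂)
chain-∷ z done                  = done
chain-∷ z (step u v r chain)    = step (z ∷ u) v r (chain-∷ z chain)

chain-trans : ∀ {a r} {A : Set a} {R : Rel A r} {w₁ w₂ w₃} →
  SwapChain R w₁ w₂ → SwapChain R w₂ w₃ → SwapChain R w₁ w₃
chain-trans c₁₂ done               = c₁₂
chain-trans c₁₂ (step u v r c₂₃)   = step u v r (chain-trans c₁₂ c₂₃)

module _ {a ℓ₁ ℓ₂} (O : DecTotalOrder a ℓ₁ ℓ₂) where
  open DecTotalOrder O using () renaming (_≤_ to _≼_; _≤?_ to _≼?_)
  open InsertionSort O using (insert; sort)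

  insert-chain : ∀ x ys → SwapChain (λ x y → ¬ x ≼ y) (insert x ys) (x ∷ ys)
  insert-chain x []       = done
  insert-chain x (y ∷ ys) with x ≼? y
  ... | yes _   = done
  ... | no x⋠y  = step [] ys x⋠y (chain-∷ y (insert-chain x ys))

  sort-chain : ∀ xs → SwapChain (λ x y → ¬ x ≼ y) (sort xs) xs
  sort-chain []       = done
  sort-chain (x ∷ xs) = chain-trans (insert-chain x (sort xs)) (chain-∷ x (sort-chain xs))

-- Counting the interleavings that produce a given word

module _ (_≟ₓ_ : DecidableEquality X) {a} (n : ℕ) (A : Vec ℕ a) (ps : Vec (List X) a) where

  outcomes : List X → ℕ
  outcomes w = length (filter (λ s → ListP.≡-dec _≟ₓ_ (interleave ps s) w) (interleavings n A))

  outcomes-swap : ∀ {_≼_ : Rel X ℓ} → SortedPackets _≼_ ps → ∀ u {x y} v → ¬ (y ≼ x) →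
    length (u ++ x ∷ y ∷ v) ≡ n → outcomes (u ++ y ∷ x ∷ v) ≤ outcomes (u ++ x ∷ y ∷ v)
  outcomes-swap sorted u {x} {y} v y⋠x ∣w∣ = begin
    outcomes w′                                           ≡⟨ length-filter-filter has-content (produces w′) (words a n) ⟩
    ∑ (𝟙 (has-content ∩? produces w′)) (words a n)         ≤⟨ ∑-words-mono n exchange ⟩
    ∑ (λ s → 𝟙 (has-content ∩? produces w) (swapAt p s)) (words a n)
                                                          ≡⟨ sym (∑-words-swapAt p n _) ⟩
    ∑ (𝟙 (has-content ∩? produces w)) (words a n)          ≡⟨ sym (length-filter-filter has-content (produces w) (words a n)) ⟩
    outcomes w                                            ∎
    where
    open ℕP.≤-Reasoning
    w w′ : List X
    w  = u ++ x ∷ y ∷ v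
    w′ = u ++ y ∷ x ∷ v
    p = length u
    has-content : Decidable (λ s → content s ≡ A)
    has-content s = VecP.≡-dec ℕ._≟_ (content s) A
    produces : (t : List X) → Decidable (λ s → interleave ps s ≡ t)
    produces t s = ListP.≡-dec _≟ₓ_ (interleave ps s) t
    exchange : ∀ s → length s ≡ n → 𝟙 (has-content ∩? produces w′) s ≤ 𝟙 (has-content ∩? produces w) (swapAt p s)
    exchange s ∣s∣ = 𝟙-mono (has-content ∩? produces w′) (has-content ∩? produces w) {s} {swapAt p s} λ (c , e) →
      trans (VecP.tabulate-cong (λ j → count-↭ j (swapAt-↭ p s))) c ,
      interleave-swapAt ps sorted u v s y⋠x (trans ∣s∣ (trans (sym ∣w∣) (length-exchange u v))) e

  outcomes-chain : ∀ {_≼_ : Rel X ℓ} → SortedPackets _≼_ ps → ∀ {w₁ w₂} →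
    SwapChain (λ x y → ¬ (y ≼ x)) w₁ w₂ → length w₂ ≡ n → outcomes w₁ ≤ outcomes w₂
  outcomes-chain sorted done ∣w∣ = ℕP.≤-refl
  outcomes-chain sorted (step u v y⋠x chain) ∣w∣ =
    ℕP.≤-trans (outcomes-chain sorted chain (trans (length-exchange u v) ∣w∣))
               (outcomes-swap sorted u v y⋠x ∣w∣)

-- Sorting labels decreasingly

module _ {m : ℕ} where

  private
    decreasing : DecTotalOrder _ _ _
    decreasing = Flip.decTotalOrder (FinP.≤-decTotalOrder m)

  sortDesc : List (Fin m) → List (Fin m)
  sortDesc = InsertionSort.sort decreasing

  sortDesc-descending : ∀ w → AllPairs (flip Fin._≤_) (sortDesc w)
  sortDesc-descending w =
    Linked⇒AllPairs (λ y≤x z≤y → FinP.≤-trans z≤y y≤x) (InsertionSortP.sort-↗ decreasing w)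

  sortDesc-↭ : ∀ w → sortDesc w ↭ w
  sortDesc-↭ = InsertionSortP.sort-↭ decreasing

  sortDesc-chain : ∀ w → SwapChain (λ x y → ¬ (y Fin.≤ x)) (sortDesc w) w
  sortDesc-chain = sort-chain decreasing

sortDesc-arrangement : ∀ {m} (D : Fin m → ℕ) w → IsArrangement D w → sortDesc w ≡ reverse (sortedDeck D)
sortDesc-arrangement D w w-arr =
  sorted-unique FinP.≤-refl (λ y≤x x≤y → FinP.≤-antisym x≤y y≤x)
    (sortDesc-descending w) (reverse-sorted (sortedDeck-ascending D)) same-counts
  where
  same-counts : ∀ i → count i (sortDesc w) ≡ count i (reverse (sortedDeck D))
  same-counts i = begin
    count i (sortDesc w)                 ≡⟨ count-↭ i (sortDesc-↭ w) ⟩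
    count i w                            ≡⟨ w-arr i ⟩
    D i                                  ≡⟨ sym (count-sortedDeck D i) ⟩
    count i (sortedDeck D)               ≡⟨ sym (count-↭ i (↭-reverse (sortedDeck D))) ⟩
    count i (reverse (sortedDeck D))     ∎
    where open ≡-Reasoning

-- Monotonicity of Q

÷ℕ-nonNeg : ∀ x d → NonNegative (x ÷ℕ d)
÷ℕ-nonNeg x zero    = _
÷ℕ-nonNeg x (suc d) = ℚP.normalize-nonNeg x (suc d)

÷ℕ-monoˡ : ∀ {x y} d → x ≤ y → x ÷ℕ d ≤ℚ y ÷ℕ d
÷ℕ-monoˡ zero    _   = ℚP.≤-refl
÷ℕ-monoˡ {x} {y} (suc d) x≤y = ℚP.toℚᵘ-cancel-≤
  (ℚᵘP.≤-respʳ-≃ (ℚᵘP.≃-sym (ℚP.toℚᵘ-fromℚᵘ (ℚᵘ.mkℚᵘ (ℤ.+ y) d)))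
  (ℚᵘP.≤-respˡ-≃ (ℚᵘP.≃-sym (ℚP.toℚᵘ-fromℚᵘ (ℚᵘ.mkℚᵘ (ℤ.+ x) d)))
  (ℚᵘ.*≤* (ℤP.*-monoʳ-≤-nonNeg (ℤ.+ suc d) (ℤ.+≤+ x≤y)))))

cutProb-nonNeg : ∀ a n (A : Vec ℕ a) → NonNegative (cutProb a n A)
cutProb-nonNeg a n A =
  ℚP.nonNeg*nonNeg⇒nonNeg (multinomial n A) {{÷ℕ-nonNeg (n ℕ.!) (product (Vec.toList (Vec.map ℕ._! A)))}}
                          (1 ÷ℕ (a ℕ.^ n)) {{÷ℕ-nonNeg 1 (a ℕ.^ n)}}

sumℚ-mono : ∀ (f g : X → ℚ) → (∀ x → f x ≤ℚ g x) → ∀ xs → sumℚ (map f xs) ≤ℚ sumℚ (map g xs)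
sumℚ-mono f g f≤g []       = ℚP.≤-refl
sumℚ-mono f g f≤g (x ∷ xs) = ℚP.+-mono-≤ (f≤g x) (sumℚ-mono f g f≤g xs)

Q-mono : ∀ {m} a (deck w₁ w₂ : List (Fin m)) →
  (∀ A → outcomes _≟_ (length deck) A (cut A deck) w₁ ≤ outcomes _≟_ (length deck) A (cut A deck) w₂) →
  Q a deck w₁ ≤ℚ Q a deck w₂
Q-mono a deck w₁ w₂ more = sumℚ-mono _ _ term-mono (compositions a n)
  where
  n = length deck
  L : Vec ℕ a → ℕ
  L A = length (interleavings n A)
  out : Vec ℕ a → List (Fin _) → ℕ
  out A = outcomes _≟_ n A (cut A deck)
  term-mono : ∀ A → cutProb a n A ℚ.* (out A w₁ ÷ℕ L A) ≤ℚ cutProb a n A ℚ.* (out A w₂ ÷ℕ L A)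
  term-mono A = ℚP.*-monoˡ-≤-nonNeg (cutProb a n A) {{cutProb-nonNeg a n A}}
                  (÷ℕ-monoˡ (L A) (more A))

proposition4p1 : (m : ℕ) → 1 ≤ m → (D : Fin m → ℕ) → (∀ i → 1 ≤ D i) →
    (a : ℕ) → 1 ≤ a → (w : List (Fin m)) → IsArrangement D w →
    Q a (sortedDeck D) (reverse (sortedDeck D)) ≤ℚ Q a (sortedDeck D) w
proposition4p1 m _ D _ a _ w w-arr = Q-mono a deck w* w fewer-outcomes
  where
  deck = sortedDeck D
  w* = reverse deck
  n = length deck
  sorted-w≡w* : sortDesc w ≡ w*
  sorted-w≡w* = sortDesc-arrangement D w w-arr
  ∣w∣ : length w ≡ n
  ∣w∣ = trans (sym (↭-length (sortDesc-↭ w))) (trans (cong length sorted-w≡w*) (ListP.length-reverse deck))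
  fewer-outcomes : ∀ A → outcomes _≟_ n A (cut A deck) w* ≤ outcomes _≟_ n A (cut A deck) w
  fewer-outcomes A = subst (λ v → outcomes _≟_ n A (cut A deck) v ≤ outcomes _≟_ n A (cut A deck) w) sorted-w≡w*
    (outcomes-chain _≟_ n A (cut A deck) (cut-sorted A (sortedDeck-ascending D)) (sortDesc-chain w) ∣w∣)
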